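{- Let $w$ be a word of length $n$ over the alphabet $\Sigma$ and let $h,p$ be integers with $h\ge0$, $p\ge1$ and $h+p\le n$. If $(h,p)$ is not an Abelian period of $w$, then $(h,p)$ is not an Abelian period of $wa$ for any letter $a\in\Sigma$.
   Context: Let $\Sigma=\{a_1,\dots,a_\sigma\}$ be a finite alphabet. For a word $u$, $|u|_b$ is the number of occurrences of letter $b$ in $u$, the Parikh vector is $\mathcal{P}_u=(|u|_{a_1},\dots,|u|_{a_\sigma})$ and its norm $|\mathcal{P}_u|$ is the sum of components. For Parikh vectors, $\mathcal{P}\subset\mathcal{Q}$ means $\mathcal{P}[j]\le\mathcal{Q}[j]$ for all $j$ and $|\mathcal{P}|<|\mathcal{Q}|$. A word $u$ has Abelian period $(h,p)$ if $u=u_0u_1\cdots u_{k-1}u_k$ for some $k\ge2$ with $\mathcal{P}_{u_0}\subset\mathcal{P}_{u_1}=\cdots=\mathcal{P}_{u_{k-1}}\supset\mathcal{P}_{u_k}$, $|u_0|=h$, $|u_1|=p$ (the head $u_0$ and tail $u_k$ may be empty). $wa$ denotes the concatenation of $w$ with the letter $a$. -}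

module Defs where

open import Data.Nat using (ℕ; zero; suc; _+_; _≤_; _<_)
open import Data.Fin using (Fin)
open import Data.List using (List; []; _∷_; length; concat; _++_; [_])
open import Data.List.Relation.Unary.All using (All)
open import Data.Product using (Σ; _×_; ∃-syntax)
open import Relation.Binary.PropositionalEquality using (_≡_)
open import Relation.Nullary using (Dec; does)
open import Data.Fin using (_≟_)
open import Data.Bool using (if_then_else_)

Word : ℕ → Set
Word σ = List (Fin σ)

count : {σ : ℕ} → Fin σ → Word σ → ℕ
count b [] = 0
count b (x ∷ u) = if does (b Data.Fin.≟ x) then suc (count b u) else count b u

Parikh : {σ : ℕ} → Word σ → (Fin σ → ℕ)
Parikh u b = count b u

norm : {σ : ℕ} → (Fin σ → ℕ) → ℕ
norm {zero} P = 0
norm {suc σ} P = P Data.Fin.zero + norm {σ} (λ j → P (Data.Fin.suc j))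

_⊂_ : {σ : ℕ} → (Fin σ → ℕ) → (Fin σ → ℕ) → Set
P ⊂ Q = (∀ j → P j ≤ Q j) × (norm P < norm Q)

-- u has Abelian period (h,p): u = u0 u1 ... u_{k-1} u_k with k ≥ 2,
-- P_{u0} ⊂ P_{u1} = ... = P_{u_{k-1}} ⊃ P_{uk}, |u0| = h, |u1| = p.
-- Here the middle blocks u1,...,u_{k-1} are u1 ∷ rest (so k - 1 ≥ 1, i.e. k ≥ 2).
AbelianPeriod : {σ : ℕ} → Word σ → ℕ → ℕ → Set
AbelianPeriod {σ} u h p =
  Σ (Word σ) λ u0 → Σ (Word σ) λ u1 → Σ (List (Word σ)) λ rest → Σ (Word σ) λ uk →
    (u ≡ u0 ++ concat (u1 ∷ rest) ++ uk)
    × (Parikh u0 ⊂ Parikh u1)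
    × All (λ v → ∀ j → Parikh v j ≡ Parikh u1 j) rest
    × (Parikh uk ⊂ Parikh u1)
    × (length u0 ≡ h)
    × (length u1 ≡ p)

module Submission where

-- Suppose w·a = u0 u1 ⋯ u(k-1) uk witnesses the Abelian period
-- (h,p) of w·a.  We cut the last letter off the factorisation:
--   * if the tail uk is nonempty, uk = t·b, and dropping b leaves a tail t
--     with P_t ⊂ P_u1 (componentwise smaller, and one letter shorter);
--   * if uk is empty and there are at least two middle blocks, the last block
--     v = t·b is nonempty (it has the Parikh vector of u1, whose norm exceeds
--     that of u0), and t becomes the new tail, again with P_t ⊂ P_u1;
--   * if uk is empty and u1 is the only block, then |w| + 1 = h + p, which
--     contradicts h + p ≤ |w|.
-- In the first two cases w = u0 u1 ⋯ t, an Abelian period (h,p) of w.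

open import Defs
open import Data.Nat using (ℕ; zero; suc; _+_; _≤_; _<_; z≤n; s≤s)
open import Data.Nat.Properties
  using (+-comm; +-commutativeSemigroup; m≤m+n; ≤-reflexive; ≤-trans; <-≤-trans; <⇒≤; <⇒≱; <-irrefl)
open import Algebra.Properties.CommutativeSemigroup +-commutativeSemigroup using (interchange)
open import Data.Fin using (Fin)
import Data.Fin as F
open import Data.List using (List; []; _∷_; length; _++_; [_]; _∷ʳ_; concat)
open import Data.List.Properties using (++-assoc; ++-identityʳ; length-++; concat-++; ∷ʳ-injectiveˡ)
open import Data.List.Reverse using ([]; _∶_∶ʳ_; reverseView)
open import Data.List.Relation.Unary.All using (All; []; _∷_)
open import Data.List.Relation.Unary.All.Properties using (++⁻)
open import Data.Product using (_,_; proj₁; proj₂)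
open import Data.Bool using (true; false)
open import Relation.Nullary using (¬_; does)
open import Relation.Binary.PropositionalEquality using (_≡_; refl; sym; trans; cong; cong₂; module ≡-Reasoning)

count-++ : ∀ {σ} (b : Fin σ) (u v : Word σ) → count b (u ++ v) ≡ count b u + count b v
count-++ b []      v = refl
count-++ b (x ∷ u) v with does (b F.≟ x)
... | true  = cong suc (count-++ b u v)
... | false = count-++ b u v

norm-cong : ∀ {σ} {P Q : Fin σ → ℕ} → (∀ j → P j ≡ Q j) → norm P ≡ norm Q
norm-cong {zero}  e = refl
norm-cong {suc σ} e = cong₂ _+_ (e F.zero) (norm-cong (λ j → e (F.suc j)))

norm-+ : ∀ {σ} (P Q : Fin σ → ℕ) → norm (λ j → P j + Q j) ≡ norm P + norm Q
norm-+ {zero}  P Q = refl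
norm-+ {suc σ} P Q = begin
  P F.zero + Q F.zero + norm (λ j → P (F.suc j) + Q (F.suc j))
    ≡⟨ cong (P F.zero + Q F.zero +_) (norm-+ (λ j → P (F.suc j)) (λ j → Q (F.suc j))) ⟩
  P F.zero + Q F.zero + (norm (λ j → P (F.suc j)) + norm (λ j → Q (F.suc j)))
    ≡⟨ interchange (P F.zero) (Q F.zero) _ _ ⟩
  P F.zero + norm (λ j → P (F.suc j)) + (Q F.zero + norm (λ j → Q (F.suc j)))  ∎
  where open ≡-Reasoning

norm-zero : ∀ {σ} → norm {σ} (λ _ → 0) ≡ 0
norm-zero {zero}  = refl
norm-zero {suc σ} = norm-zero {σ}

norm-letter : ∀ {σ} (a : Fin σ) → norm (Parikh [ a ]) ≡ 1
norm-letter {suc σ} F.zero    = cong suc (norm-zero {σ})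
norm-letter {suc σ} (F.suc a) = norm-letter a

norm-Parikh : ∀ {σ} (u : Word σ) → norm (Parikh u) ≡ length u
norm-Parikh {σ} []  = norm-zero {σ}
norm-Parikh (x ∷ u) = begin
  norm (Parikh ([ x ] ++ u))                  ≡⟨ norm-cong (λ j → count-++ j [ x ] u) ⟩
  norm (λ j → count j [ x ] + count j u)      ≡⟨ norm-+ (Parikh [ x ]) (Parikh u) ⟩
  norm (Parikh [ x ]) + norm (Parikh u)       ≡⟨ cong₂ _+_ (norm-letter x) (norm-Parikh u) ⟩
  suc (length u)                              ∎
  where open ≡-Reasoning

length-∷ʳ : ∀ {A : Set} (u : List A) (b : A) → length (u ∷ʳ b) ≡ suc (length u)
length-∷ʳ u b = trans (length-++ u) (+-comm (length u) 1)

-- If P_{t·b} is componentwise below Q with norm at most |Q|, then P_t ⊂ Q: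
-- removing the last letter turns a (possibly full) block into a proper tail.
drop-last-letter : ∀ {σ} (t : Word σ) (b : Fin σ) (Q : Fin σ → ℕ) →
  (∀ j → Parikh (t ∷ʳ b) j ≤ Q j) → norm (Parikh (t ∷ʳ b)) ≤ norm Q → Parikh t ⊂ Q
drop-last-letter t b Q below norm≤ = count≤ , norm<
  where
  count≤ : ∀ j → count j t ≤ Q j
  count≤ j = ≤-trans (≤-trans (m≤m+n (count j t) (count j [ b ]))
                              (≤-reflexive (sym (count-++ j t [ b ])))) (below j)
  norm< : norm (Parikh t) < norm Q
  norm< = <-≤-trans (≤-reflexive (cong suc (norm-Parikh t)))
            (≤-trans (≤-reflexive (sym (trans (norm-Parikh (t ∷ʳ b)) (length-∷ʳ t b)))) norm≤)

concat-∷ʳ : ∀ {A : Set} (xss : List (List A)) (ys : List A) → concat (xss ∷ʳ ys) ≡ concat xss ++ ys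
concat-∷ʳ xss ys = trans (sym (concat-++ xss [ ys ])) (cong (concat xss ++_) (++-identityʳ ys))

cut-last-letter : ∀ {σ} (w x y t : Word σ) (a b : Fin σ) →
  w ∷ʳ a ≡ x ++ y ++ (t ∷ʳ b) → w ≡ x ++ y ++ t
cut-last-letter w x y t a b eq = ∷ʳ-injectiveˡ w (x ++ y ++ t) (begin
  w ∷ʳ a                  ≡⟨ eq ⟩
  x ++ y ++ t ++ [ b ]    ≡⟨ cong (x ++_) (++-assoc y t [ b ]) ⟨
  x ++ (y ++ t) ++ [ b ]  ≡⟨ ++-assoc x (y ++ t) [ b ] ⟨
  (x ++ y ++ t) ∷ʳ b      ∎)
  where open ≡-Reasoning

period-without-last-letter : ∀ {σ} {w : Word σ} {a : Fin σ} {h p : ℕ}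
  (u0 u1 : Word σ) (rest : List (Word σ)) (t : Word σ) (b : Fin σ) →
  w ∷ʳ a ≡ u0 ++ concat (u1 ∷ rest) ++ (t ∷ʳ b) →
  Parikh u0 ⊂ Parikh u1 →
  All (λ v → ∀ j → Parikh v j ≡ Parikh u1 j) rest →
  (∀ j → Parikh (t ∷ʳ b) j ≤ Parikh u1 j) → norm (Parikh (t ∷ʳ b)) ≤ norm (Parikh u1) →
  length u0 ≡ h → length u1 ≡ p → AbelianPeriod w h p
period-without-last-letter {w = w} {a} u0 u1 rest t b eq head⊂ blocks below norm≤ len0 len1 =
  u0 , u1 , rest , t , cut-last-letter w u0 (concat (u1 ∷ rest)) t a b eq ,
  head⊂ , blocks , drop-last-letter t b (Parikh u1) below norm≤ , len0 , len1

-- Every middle block is nonempty, since its norm equals |P_u1| > |P_u0| ≥ 0.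
block-nonempty : ∀ {σ} (u0 u1 v : Word σ) →
  Parikh u0 ⊂ Parikh u1 → (∀ j → Parikh v j ≡ Parikh u1 j) → 0 < length v
block-nonempty u0 u1 v head⊂ v≈u1 =
  ≤-trans (≤-trans (s≤s z≤n) (proj₂ head⊂))
          (≤-reflexive (trans (sym (norm-cong v≈u1)) (norm-Parikh v)))

single-block-length : ∀ {σ} {h p : ℕ} (w u0 u1 : Word σ) (a : Fin σ) →
  w ∷ʳ a ≡ u0 ++ (u1 ++ []) ++ [] → length u0 ≡ h → length u1 ≡ p →
  suc (length w) ≡ h + p
single-block-length w u0 u1 a eq len0 len1 = begin
  suc (length w)                    ≡⟨ length-∷ʳ w a ⟨
  length (w ∷ʳ a)                   ≡⟨ cong length eq ⟩
  length (u0 ++ (u1 ++ []) ++ [])   ≡⟨ cong (λ z → length (u0 ++ z)) (trans (++-identityʳ _) (++-identityʳ u1)) ⟩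
  length (u0 ++ u1)                 ≡⟨ length-++ u0 ⟩
  length u0 + length u1             ≡⟨ cong₂ _+_ len0 len1 ⟩
  _                                 ∎
  where open ≡-Reasoning

proposition7 : {σ : ℕ} (w : Word σ) (h p : ℕ) →
    1 ≤ p → h + p ≤ length w →
    ¬ AbelianPeriod w h p →
    (a : Fin σ) → ¬ AbelianPeriod (w ++ [ a ]) h p
proposition7 w h p _ h+p≤|w| notPeriod a (u0 , u1 , rest , uk , eq , head⊂ , blocks , tail⊂ , len0 , len1)
  with reverseView uk
-- nonempty tail uk = t·b: shorten the tail
... | t ∶ _ ∶ʳ b = notPeriod (period-without-last-letter u0 u1 rest t b eq head⊂ blocks
                                (proj₁ tail⊂) (<⇒≤ (proj₂ tail⊂)) len0 len1)
... | [] with reverseView rest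
-- empty tail, single block: w·a is too short
...   | [] = <⇒≱ (≤-reflexive (single-block-length w u0 u1 a eq len0 len1)) h+p≤|w|
-- empty tail, last block v: shorten v, which becomes the tail
...   | rest′ ∶ _ ∶ʳ v with ++⁻ rest′ blocks
...     | blocks′ , (v≈u1 ∷ []) with reverseView v
...       | [] = <-irrefl refl (block-nonempty u0 u1 [] head⊂ v≈u1)
...       | t ∶ _ ∶ʳ b = notPeriod (period-without-last-letter u0 u1 rest′ t b
                            (trans eq (cong (u0 ++_) (trans (++-identityʳ _) (concat-∷ʳ (u1 ∷ rest′) (t ∷ʳ b))))) head⊂ blocks′
                            (λ j → ≤-reflexive (v≈u1 j)) (≤-reflexive (norm-cong v≈u1)) len0 len1)
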